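{- (Prop$_1$) is correct at every pseudo-symmetric $\Box\Diamond^{ -1}$-model, and (Prop$_2$) is correct at every reflexive $\Box\Diamond^{ -1}$-model.
   Context: Formulas are built from propositional letters and $\bot$ using $\land,\lor,\to$; $\top:=\bot\to\bot$. For a frame $\mathfrak F=\langle W,R\rangle$, $X\subseteq W$: $\Box_{\mathfrak F}X=\{w\mid\forall v(wRv\Rightarrow v\in X)\}$, $\Diamond_{\mathfrak F}X=W\setminus\Box_{\mathfrak F}(W\setminus X)$, $\Diamond^{ -1}_{\mathfrak F}X=\{w\mid\exists x\in X,\ xRw\}$, $FP_{\mathfrak F}=\{\Box_{\mathfrak F}X\mid X\subseteq W\}$. A $\Box\Diamond^{ -1}$-model is a Kripke model with $V(p)\in FP_{\mathfrak F}$ for all $p$; truth sets: $\|p\|=V(p)$, $\|\bot\|=\Box_{\mathfrak F}\emptyset$, $\|\alpha\land\beta\|=\|\alpha\|\cap\|\beta\|$, $\|\alpha\to\beta\|=\Box_{\mathfrak F}((W\setminus\|\alpha\|)\cup\|\beta\|)$, $\|\alpha\lor\beta\|=\Box_{\mathfrak F}\Diamond^{ -1}_{\mathfrak F}(\|\alpha\|\cup\|\beta\|)$. A frame is pseudo-symmetric iff every $w\in\Box_{\mathfrak F}\Diamond_{\mathfrak F}\Box_{\mathfrak F}\Diamond^{ -1}_{\mathfrak F}\{w\}$. A rule is correct at $\mathfrak M$ iff $\vDash_{\mathfrak M}$ satisfies it, where $\alpha\vDash_{\mathfrak M}\beta$ iff every point satisfying $\alpha$ satisfies $\beta$. i-formulas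 are $\Delta\sqsupset\Theta$ with $\Delta,\Theta$ non-empty finite sets of formulas. $\Vdash_1$ is the least relation between sets of i-formulas and i-formulas satisfying: (A) $\Gamma^i\cup\{\alpha^i\}\Vdash\alpha^i$; (Cut) $\Gamma^i\Vdash\alpha^i$ and $\Phi^i\cup\{\alpha^i\}\Vdash\beta^i$ imply $\Gamma^i\cup\Phi^i\Vdash\beta^i$; (i-A) $\Delta\cap\Theta\ne\emptyset\Rightarrow\ \Vdash\Delta\sqsupset\Theta$; (i-Cut) $\{\Delta_1\sqsupset\Theta_1\cup\{\varphi\},\Delta_2\cup\{\varphi\}\sqsupset\Theta_2\}\Vdash\Delta_1\cup\Delta_2\sqsupset\Theta_1\cup\Theta_2$; (i-$\land$L) $\Vdash\{\varphi\land\psi\}\sqsupset\{\varphi\}$, $\Vdash\{\varphi\land\psi\}\sqsupset\{\psi\}$; (i-$\land$R) $\Vdash\{\varphi,\psi\}\sqsupset\{\varphi\land\psi\}$. $\Vdash^\gamma_2$ additionally satisfies ($\gamma$-Refl) $\Vdash\{\varphi_1,\dots,\varphi_n,\bigvee_j(\varphi_j\to\psi_j)\lor\gamma\}\sqsupset\{\psi_1,\dots,\psi_n\}$. $i_\gamma(\Gamma)=\{\{\varphi_1,\dots,\varphi_n\}\sqsupset\{\psi_1,\dots,\psi_n\}\mid\bigvee_j(\varphi_j\to\psi_j)\lor\gamma\in\Gamma\}$, $Th_\vdash(\alpha)=\{\varphi\mid\alpha\vdash\varphi\}$. (Prop$_1$): $i_\gamma(Th_\vdash(\alpha))\Vdash_1\{\top\}\sqsupset\{\bot\}\Rightarrow\alpha\vdash\gamma$.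 (Prop$_2$): $i_\gamma(Th_\vdash(\alpha))\Vdash^\gamma_2\{\top\}\sqsupset\{\bot\}\Rightarrow\alpha\vdash\gamma$. (Correctness at $\mathfrak M$ means these hold with $\vdash$ replaced by $\vDash_{\mathfrak M}$.) -}

module Defs where

open import Level using (Level; 0ℓ) renaming (suc to lsuc)
open import Data.Nat using (ℕ)
open import Data.Empty using (⊥)
open import Data.Product using (Σ; ∃; _×_; _,_; proj₁; proj₂)
open import Data.Sum using (_⊎_)
open import Data.List using (List)
open import Data.List.NonEmpty using (List⁺; _∷_; [_]; _∷⁺_; _⁺++_; _++⁺_; map; foldr₁; toList)
open import Data.List.Membership.Propositional using (_∈_)
open import Relation.Nullary using (¬_)
open import Relation.Binary.PropositionalEquality using (_≡_)
open import Function.Bundles using (_⇔_)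

infixr 6 _∧'_
infixr 5 _∨'_
infixr 4 _⇒'_

data Fm : Set where
  var  : ℕ → Fm
  ⊥'   : Fm
  _∧'_ : Fm → Fm → Fm
  _∨'_ : Fm → Fm → Fm
  _⇒'_ : Fm → Fm → Fm

⊤' : Fm
⊤' = ⊥' ⇒' ⊥'

⋁ : List⁺ Fm → Fm
⋁ = foldr₁ _∨'_

record Frame : Set₁ where
  field
    W : Set
    R : W → W → Set
open Frame public

module _ (F : Frame) where
  Sub : Set₁
  Sub = W F → Set

  □ : Sub → Sub
  □ X w = ∀ v → R F w v → X v

  ◇ : Sub → Sub
  ◇ X w = ¬ (□ (λ v → ¬ X v) w)

  ◇⁻¹ : Sub → Sub
  ◇⁻¹ X w = Σ (W F) λ x → X x × R F x w

  InFP : Sub → Set₁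
  InFP Y = Σ Sub λ X → ∀ w → Y w ⇔ □ X w

  PseudoSymmetric : Set
  PseudoSymmetric = ∀ w → □ (◇ (□ (◇⁻¹ (λ v → v ≡ w)))) w

  Reflexive : Set
  Reflexive = ∀ w → R F w w

record Model : Set₁ where
  field
    frame : Frame
    V     : ℕ → W frame → Set
    V-FP  : ∀ p → InFP frame (V p)
open Model public

‖_‖ : Fm → (M : Model) → W (frame M) → Set
‖ var p ‖ M = V M p
‖ ⊥' ‖ M = □ (frame M) (λ _ → ⊥)
‖ a ∧' b ‖ M = λ w → ‖ a ‖ M w × ‖ b ‖ M w
‖ a ⇒' b ‖ M = □ (frame M) (λ w → ¬ ‖ a ‖ M w ⊎ ‖ b ‖ M w)
‖ a ∨' b ‖ M = □ (frame M) (◇⁻¹ (frame M) (λ w → ‖ a ‖ M w ⊎ ‖ b ‖ M w))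

_⊨[_]_ : Fm → Model → Fm → Set
α ⊨[ M ] β = ∀ w → ‖ α ‖ M w → ‖ β ‖ M w

-- i-formulas  Δ ⊐ Θ  (Δ, Θ non-empty finite sets, represented by
-- non-empty lists, identified up to having the same members)

IFm : Set
IFm = List⁺ Fm × List⁺ Fm

infix 3 _⊐_
_⊐_ : List⁺ Fm → List⁺ Fm → IFm
Δ ⊐ Θ = Δ , Θ

_≈ˢ_ : List⁺ Fm → List⁺ Fm → Set
Δ ≈ˢ Δ' = ∀ φ → (φ ∈ toList Δ) ⇔ (φ ∈ toList Δ')

_≈ⁱ_ : IFm → IFm → Set
ι ≈ⁱ κ = (proj₁ ι ≈ˢ proj₁ κ) × (proj₂ ι ≈ˢ proj₂ κ)

ISet : Set₁
ISet = IFm → Set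

∅ⁱ : ISet
∅ⁱ _ = ⊥

_∪ⁱ_ : ISet → ISet → ISet
(Γ ∪ⁱ Φ) ι = Γ ι ⊎ Φ ι

｛_｝ : IFm → ISet
｛ ι ｝ κ = κ ≡ ι

｛_,_｝ : IFm → IFm → ISet
｛ ι , ι' ｝ κ = κ ≡ ι ⊎ κ ≡ ι'

_≐_ : ISet → ISet → Set
Γ ≐ Φ = (∀ ι → Γ ι → Σ IFm λ κ → Φ κ × ι ≈ⁱ κ)
      × (∀ κ → Φ κ → Σ IFm λ ι → Γ ι × ι ≈ⁱ κ)

IRel : Set₁
IRel = ISet → IFm → Set

-- Rel is a relation between (abstract) sets of i-formulas and i-formulas
Invariant : IRel → Set₁
Invariant Rel = ∀ {Γ Γ' ι ι'} → Rel Γ ι → Γ ≐ Γ' → ι ≈ⁱ ι' → Rel Γ' ι'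

Closed₁ : IRel → Set₁
Closed₁ Rel =
    Invariant Rel
  × (∀ Γ α → Rel (Γ ∪ⁱ ｛ α ｝) α)
  × (∀ Γ Φ α β → Rel Γ α → Rel (Φ ∪ⁱ ｛ α ｝) β → Rel (Γ ∪ⁱ Φ) β)
  × (∀ Δ Θ → (Σ Fm λ φ → φ ∈ toList Δ × φ ∈ toList Θ) → Rel ∅ⁱ (Δ ⊐ Θ))
  × (∀ (Δ₁ : List⁺ Fm) (Θ₁ Δ₂ : List Fm) (Θ₂ : List⁺ Fm) φ →
       Rel ｛ Δ₁ ⊐ φ ∷ Θ₁ , φ ∷ Δ₂ ⊐ Θ₂ ｝ (Δ₁ ⁺++ Δ₂ ⊐ Θ₁ ++⁺ Θ₂))
  × (∀ φ ψ → Rel ∅ⁱ ([ φ ∧' ψ ] ⊐ [ φ ]))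
  × (∀ φ ψ → Rel ∅ⁱ ([ φ ∧' ψ ] ⊐ [ ψ ]))
  × (∀ φ ψ → Rel ∅ⁱ (φ ∷⁺ [ ψ ] ⊐ [ φ ∧' ψ ]))

⋁⇒ : List⁺ (Fm × Fm) → Fm
⋁⇒ ps = ⋁ (map (λ p → proj₁ p ⇒' proj₂ p) ps)

Closed₂ : Fm → IRel → Set₁
Closed₂ γ Rel =
    Closed₁ Rel
  × (∀ (ps : List⁺ (Fm × Fm)) →
       Rel ∅ⁱ ((⋁⇒ ps ∨' γ) ∷⁺ map proj₁ ps ⊐ map proj₂ ps))

_⊩₁_ : ISet → IFm → Set₁
Γ ⊩₁ ι = ∀ (Rel : IRel) → Closed₁ Rel → Rel Γ ι

_⊩₂[_]_ : ISet → Fm → IFm → Set₁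
Γ ⊩₂[ γ ] ι = ∀ (Rel : IRel) → Closed₂ γ Rel → Rel Γ ι

iγTh : Model → Fm → Fm → ISet
iγTh M γ α ι = Σ (List⁺ (Fm × Fm)) λ ps →
  (ι ≡ (map proj₁ ps ⊐ map proj₂ ps)) × (α ⊨[ M ] (⋁⇒ ps ∨' γ))

⊤⊐⊥ : IFm
⊤⊐⊥ = [ ⊤' ] ⊐ [ ⊥' ]

Prop₁Correct : Model → Set₁
Prop₁Correct M = ∀ α γ → iγTh M γ α ⊩₁ ⊤⊐⊥ → α ⊨[ M ] γ

Prop₂Correct : Model → Set₁
Prop₂Correct M = ∀ α γ → iγTh M γ α ⊩₂[ γ ] ⊤⊐⊥ → α ⊨[ M ] γ

{-# OPTIONS --safe #-}
module Submission where

-- Suppose α holds at w but γ does not. Truth sets are closed under □◇⁻¹,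
-- so classically w sees a point v with no γ-point among its predecessors.
-- Read an i-formula Δ ⊐ Θ at v as "if all of Δ hold at v then some of Θ
-- does": this reading is closed under the rules of ⊩₁, and validates every
-- i-formula of i_γ(Th(α)), since a disjunction ⋁ⱼ(φⱼ → ψⱼ) ∨ γ true at w is
-- witnessed at a predecessor of v by some φⱼ → ψⱼ. Hence ⊤ ⊐ ⊥ holds at v,
-- i.e. v is a dead end. Pseudo-symmetry forbids dead ends among successors;
-- reflexivity forbids them altogether and also validates (γ-Refl) at v.

open import Defs
open import Level using (0ℓ)
open import Axiom.ExcludedMiddle using (ExcludedMiddle)
open import Axiom.DoubleNegationElimination using (em⇒dne)
open import Data.Empty using (⊥-elim)
open import Data.Product using (∃; _×_; _,_; proj₁; proj₂; map₂)
open import Data.Sum using (_⊎_; inj₁; inj₂)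
open import Data.List using (List; []; _∷_; _++_)
open import Data.List.NonEmpty as List⁺ using (List⁺; _∷_; toList; _∷⁺_; _⁺++_; _++⁺_)
open import Data.List.Relation.Unary.Any using (here; there)
open import Data.List.Membership.Propositional using (_∈_)
open import Data.List.Membership.Propositional.Properties using (∈-map⁺; ∈-map⁻; ∈-++⁺ˡ; ∈-++⁺ʳ)
open import Relation.Nullary using (¬_; yes; no)
open import Relation.Binary.PropositionalEquality using (_≡_; refl; cong)
open import Function.Bundles using (Equivalence)
open import Function.Properties.Equivalence using () renaming (sym to ⇔-sym)

toList-++⁺ : ∀ {A : Set} (xs : List A) (ys : List⁺ A) → toList (xs ++⁺ ys) ≡ xs ++ toList ys
toList-++⁺ []       (y ∷ ys) = refl
toList-++⁺ (x ∷ xs) ys with xs ++⁺ ys | toList-++⁺ xs ys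
... | z ∷ zs | eq = cong (x ∷_) eq

≈ⁱ-sym : ∀ {ι κ} → ι ≈ⁱ κ → κ ≈ⁱ ι
≈ⁱ-sym (Δ≈ , Θ≈) = (λ φ → ⇔-sym (Δ≈ φ)) , (λ φ → ⇔-sym (Θ≈ φ))

module _ (F : Frame) where

  □◇⁻¹□⊆□ : ∀ (Z : Sub F) {w} → □ F (◇⁻¹ F (□ F Z)) w → □ F Z w
  □◇⁻¹□⊆□ Z h v wRv with h v wRv
  ... | x , □Zx , xRv = □Zx v xRv

  InFP⇒□◇⁻¹-closed : ∀ {Y : Sub F} → InFP F Y → ∀ {w} → □ F (◇⁻¹ F Y) w → Y w
  InFP⇒□◇⁻¹-closed (X , Y⇔□X) {w} h = Equivalence.from (Y⇔□X w) (□◇⁻¹□⊆□ X λ v wRv →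
    map₂ (λ {x} (Yx , xRv) → Equivalence.to (Y⇔□X x) Yx , xRv) (h v wRv))

  ¬□⇒∃¬ : ExcludedMiddle 0ℓ → ∀ {X : Sub F} {w} → ¬ □ F X w → ∃ λ v → R F w v × ¬ X v
  ¬□⇒∃¬ em {X} {w} ¬□X with em {∃ λ v → R F w v × ¬ X v}
  ... | yes found = found
  ... | no  none  = ⊥-elim (¬□X λ v wRv → em⇒dne em λ ¬Xv → none (v , wRv , ¬Xv))

module Semantics (M : Model) where

  private
    F : Frame
    F = frame M

  ‖‖-□◇⁻¹-closed : ∀ φ {w} → □ F (◇⁻¹ F (‖ φ ‖ M)) w → ‖ φ ‖ M w
  ‖‖-□◇⁻¹-closed (var p)  = InFP⇒□◇⁻¹-closed F (V-FP M p)
  ‖‖-□◇⁻¹-closed ⊥'       = □◇⁻¹□⊆□ F _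
  ‖‖-□◇⁻¹-closed (a ∨' b) = □◇⁻¹□⊆□ F _
  ‖‖-□◇⁻¹-closed (a ⇒' b) = □◇⁻¹□⊆□ F _
  ‖‖-□◇⁻¹-closed (a ∧' b) h =
    ‖‖-□◇⁻¹-closed a (λ v wRv → map₂ (λ (ab , xRv) → proj₁ ab , xRv) (h v wRv)) ,
    ‖‖-□◇⁻¹-closed b (λ v wRv → map₂ (λ (ab , xRv) → proj₂ ab , xRv) (h v wRv))

  ⊤'-valid : ExcludedMiddle 0ℓ → ∀ w → ‖ ⊤' ‖ M w
  ⊤'-valid em w u _ with em {‖ ⊥' ‖ M u}
  ... | yes ⊥u = inj₂ ⊥u
  ... | no ¬⊥u = inj₁ ¬⊥u

  ¬‖‖⇒∃-succ-¬◇⁻¹ : ExcludedMiddle 0ℓ → ∀ γ {w} → ¬ ‖ γ ‖ M w →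
                    ∃ λ v → R F w v × ¬ ◇⁻¹ F (‖ γ ‖ M) v
  ¬‖‖⇒∃-succ-¬◇⁻¹ em γ ¬γw = ¬□⇒∃¬ F em λ □◇⁻¹γ → ¬γw (‖‖-□◇⁻¹-closed γ □◇⁻¹γ)

  ◇⁻¹-⇒' : ∀ φ ψ {v} → ◇⁻¹ F (‖ φ ⇒' ψ ‖ M) v → ¬ ‖ φ ‖ M v ⊎ ‖ ψ ‖ M v
  ◇⁻¹-⇒' φ ψ {v} (x , φ⇒ψx , xRv) = φ⇒ψx v xRv

  ⋁-◇⁻¹ : ∀ (φs : List⁺ Fm) {y v} → ‖ ⋁ φs ‖ M y → R F y v →
          ∃ λ φ → φ ∈ toList φs × ◇⁻¹ F (‖ φ ‖ M) v
  ⋁-◇⁻¹ (φ ∷ [])     {y} φy yRv = φ , here refl , y , φy , yRv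
  ⋁-◇⁻¹ (φ ∷ ψ ∷ φs) ⋁y yRv with ⋁y _ yRv
  ... | x , inj₁ φx , xRv = φ , here refl , x , φx , xRv
  ... | x , inj₂ ⋁x , xRv = map₂ (λ (ψ∈ , ◇⁻¹ψ) → there ψ∈ , ◇⁻¹ψ) (⋁-◇⁻¹ (ψ ∷ φs) ⋁x xRv)

  HoldsAt : W F → IFm → Set
  HoldsAt v (Δ , Θ) = (∀ φ → φ ∈ toList Δ → ‖ φ ‖ M v) → ∃ λ φ → φ ∈ toList Θ × ‖ φ ‖ M v

  ⋁⇒-holdsAt : ∀ (ps : List⁺ (Fm × Fm)) {y v} → ‖ ⋁⇒ ps ‖ M y → R F y v →
               HoldsAt v (List⁺.map proj₁ ps ⊐ List⁺.map proj₂ ps)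
  -- Matching ps lets toList (List⁺.map f ps) compute to List.map f (toList ps).
  ⋁⇒-holdsAt ps@(_ ∷ _) ⋁y yRv Δv with ⋁-◇⁻¹ (List⁺.map (λ p → proj₁ p ⇒' proj₂ p) ps) ⋁y yRv
  ... | _ , χ∈ , ◇⁻¹χ with ∈-map⁻ (λ p → proj₁ p ⇒' proj₂ p) χ∈
  ...   | (φ , ψ) , p∈ , refl with ◇⁻¹-⇒' φ ψ ◇⁻¹χ
  ...     | inj₁ ¬φv = ⊥-elim (¬φv (Δv φ (∈-map⁺ proj₁ p∈)))
  ...     | inj₂ ψv  = ψ , ∈-map⁺ proj₂ p∈ , ψv

  ⋁⇒∨'-holdsAt : ∀ γ ps {x v} → ‖ ⋁⇒ ps ∨' γ ‖ M x → R F x v → ¬ ◇⁻¹ F (‖ γ ‖ M) v →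
                 HoldsAt v (List⁺.map proj₁ ps ⊐ List⁺.map proj₂ ps)
  ⋁⇒∨'-holdsAt γ ps ∨x xRv ¬◇⁻¹γ with ∨x _ xRv
  ... | y , inj₁ ⋁y , yRv = ⋁⇒-holdsAt ps ⋁y yRv
  ... | y , inj₂ γy , yRv = ⊥-elim (¬◇⁻¹γ (y , γy , yRv))

  iγTh-holdsAt : ∀ γ α {w v} → ‖ α ‖ M w → R F w v → ¬ ◇⁻¹ F (‖ γ ‖ M) v →
                 ∀ ι → iγTh M γ α ι → HoldsAt v ι
  iγTh-holdsAt γ α αw wRv ¬◇⁻¹γ _ (ps , refl , α⊨) = ⋁⇒∨'-holdsAt γ ps (α⊨ _ αw) wRv ¬◇⁻¹γ

  ⊤⊐⊥-holdsAt⇒deadEnd : ExcludedMiddle 0ℓ → ∀ {v} → HoldsAt v ⊤⊐⊥ → ‖ ⊥' ‖ M v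
  ⊤⊐⊥-holdsAt⇒deadEnd em {v} h with h (λ { _ (here refl) → ⊤'-valid em v })
  ... | _ , here refl , ⊥v = ⊥v

  holdsAt-resp-≈ⁱ : ∀ {v ι κ} → ι ≈ⁱ κ → HoldsAt v ι → HoldsAt v κ
  holdsAt-resp-≈ⁱ (Δ≈ , Θ≈) h Δ'v =
    map₂ (λ {φ} (φ∈ , φv) → Equivalence.to (Θ≈ φ) φ∈ , φv)
         (h λ φ φ∈ → Δ'v φ (Equivalence.to (Δ≈ φ) φ∈))

  SoundAt : W F → IRel
  SoundAt v Γ ι = (∀ κ → Γ κ → HoldsAt v κ) → HoldsAt v ι

  soundAt-invariant : ∀ {v} → Invariant (SoundAt v)
  soundAt-invariant sound (Γ⊆Γ' , _) ι≈ι' Γ'v = holdsAt-resp-≈ⁱ ι≈ι' (sound λ κ κ∈Γ →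
    let (κ' , κ'∈Γ' , κ≈κ') = Γ⊆Γ' κ κ∈Γ in holdsAt-resp-≈ⁱ (≈ⁱ-sym κ≈κ') (Γ'v κ' κ'∈Γ'))

  soundAt-i-cut : ∀ {v} (Δ₁ : List⁺ Fm) (Θ₁ Δ₂ : List Fm) (Θ₂ : List⁺ Fm) φ →
                  SoundAt v ｛ Δ₁ ⊐ φ ∷ Θ₁ , φ ∷ Δ₂ ⊐ Θ₂ ｝ (Δ₁ ⁺++ Δ₂ ⊐ Θ₁ ++⁺ Θ₂)
  soundAt-i-cut (δ ∷ δs) Θ₁ Δ₂ Θ₂ φ premises Δv
    rewrite toList-++⁺ Θ₁ Θ₂
    with premises _ (inj₁ refl) (λ ψ ψ∈ → Δv ψ (∈-++⁺ˡ ψ∈))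
  ... | ψ , there ψ∈ , ψv  = ψ , ∈-++⁺ˡ ψ∈ , ψv
  ... | _ , here refl , φv =
    map₂ (λ (χ∈ , χv) → ∈-++⁺ʳ Θ₁ χ∈ , χv)
         (premises _ (inj₂ refl) λ { _ (here refl) → φv ; ψ (there ψ∈) → Δv ψ (∈-++⁺ʳ (δ ∷ δs) ψ∈) })

  soundAt-closed₁ : ∀ {v} → Closed₁ (SoundAt v)
  soundAt-closed₁ =
      soundAt-invariant
    , (λ Γ α Γv → Γv α (inj₂ refl))
    , (λ Γ Φ α β Γ⊢α Φα⊢β ΓΦv → Φα⊢β λ { κ (inj₁ κ∈Φ) → ΓΦv κ (inj₂ κ∈Φ)
                                         ; _ (inj₂ refl) → Γ⊢α λ κ κ∈Γ → ΓΦv κ (inj₁ κ∈Γ) })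
    , (λ Δ Θ (φ , φ∈Δ , φ∈Θ) _ Δv → φ , φ∈Θ , Δv φ φ∈Δ)
    , soundAt-i-cut
    , (λ φ ψ _ Δv → φ , here refl , proj₁ (Δv _ (here refl)))
    , (λ φ ψ _ Δv → ψ , here refl , proj₂ (Δv _ (here refl)))
    , (λ φ ψ _ Δv → φ ∧' ψ , here refl , Δv φ (here refl) , Δv ψ (there (here refl)))

  soundAt-closed₂ : ∀ γ {v} → R F v v → ¬ ◇⁻¹ F (‖ γ ‖ M) v → Closed₂ γ (SoundAt v)
  soundAt-closed₂ γ vRv ¬◇⁻¹γ = soundAt-closed₁ , γ-refl
    where
    γ-refl : ∀ ps → SoundAt _ ∅ⁱ ((⋁⇒ ps ∨' γ) ∷⁺ List⁺.map proj₁ ps ⊐ List⁺.map proj₂ ps)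
    γ-refl (p ∷ ps) _ Δv = ⋁⇒∨'-holdsAt γ (p ∷ ps) (Δv _ (here refl)) vRv ¬◇⁻¹γ (λ φ φ∈ → Δv φ (there φ∈))

lemma12 : ExcludedMiddle 0ℓ →
    (∀ (M : Model) → PseudoSymmetric (frame M) → Prop₁Correct M)
    × (∀ (M : Model) → Reflexive (frame M) → Prop₂Correct M)
lemma12 em = prop₁ , prop₂
  where
  prop₁ : ∀ M → PseudoSymmetric (frame M) → Prop₁Correct M
  prop₁ M pseudoSym α γ ⊩⊤⊐⊥ w αw = em⇒dne em λ ¬γw →
    let open Semantics M
        (v , wRv , ¬◇⁻¹γ) = ¬‖‖⇒∃-succ-¬◇⁻¹ em γ ¬γw
        deadEnd = ⊤⊐⊥-holdsAt⇒deadEnd em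
                    (⊩⊤⊐⊥ (SoundAt v) soundAt-closed₁ (iγTh-holdsAt γ α αw wRv ¬◇⁻¹γ))
    in pseudoSym w v wRv λ u vRu _ → deadEnd u vRu

  prop₂ : ∀ M → Reflexive (frame M) → Prop₂Correct M
  prop₂ M reflexive α γ ⊩⊤⊐⊥ w αw = em⇒dne em λ ¬γw →
    let open Semantics M
        (v , wRv , ¬◇⁻¹γ) = ¬‖‖⇒∃-succ-¬◇⁻¹ em γ ¬γw
        deadEnd = ⊤⊐⊥-holdsAt⇒deadEnd em
                    (⊩⊤⊐⊥ (SoundAt v) (soundAt-closed₂ γ (reflexive v) ¬◇⁻¹γ) (iγTh-holdsAt γ α αw wRv ¬◇⁻¹γ))
    in deadEnd v (reflexive v)
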